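{- If $k,\ell,m,n\in\mathbb{N}$ with $k\leq m$ and $\ell\leq n$, then $E(k,\ell)\leq E(m,n)$.
   Context: $G(m,n)$ is the grid graph on $[m]\times[n]$ with edges between vertices at Euclidean distance 1. In 2-neighbour bootstrap percolation, a vertex becomes infected once at least 2 of its neighbours are infected, infected vertices stay infected; an initial set percolates if eventually all vertices are infected. A minimal percolating set is a percolating set none of whose proper subsets percolates. $E(m,n)$ is the maximum size of a minimal percolating set of $G(m,n)$. -}

module Defs where

open import Data.Nat using (ℕ; zero; suc; _≤_)
open import Data.Fin using (Fin; toℕ)
open import Data.Bool using (Bool; true; false; if_then_else_)
open import Data.List using (map; allFin)
open import Data.Nat.ListAction using (sum)
open import Data.Product using (_×_; _,_; Σ; ∃)
open import Data.Sum using (_⊎_)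
open import Relation.Binary.PropositionalEquality using (_≡_; _≢_)
open import Relation.Nullary using (¬_)

Vertex : ℕ → ℕ → Set
Vertex m n = Fin m × Fin n

Adj : ∀ {m n} → Vertex m n → Vertex m n → Set
Adj (i , j) (i' , j') =
  (toℕ i ≡ toℕ i' × (suc (toℕ j) ≡ toℕ j' ⊎ suc (toℕ j') ≡ toℕ j))
  ⊎ (toℕ j ≡ toℕ j' × (suc (toℕ i) ≡ toℕ i' ⊎ suc (toℕ i') ≡ toℕ i))

VSet : ℕ → ℕ → Set
VSet m n = Vertex m n → Bool

size : ∀ {m n} → VSet m n → ℕ
size {m} {n} A =
  sum (map (λ i → sum (map (λ j → if A (i , j) then 1 else 0) (allFin n))) (allFin m))

-- Vertices eventually infected from initial set A in 2-neighbour bootstrap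
-- percolation (the closure of A under the infection rule).
data Infected {m n : ℕ} (A : VSet m n) : Vertex m n → Set where
  initial : ∀ {v} → A v ≡ true → Infected A v
  spread  : ∀ {v u w} → u ≢ w → Adj v u → Adj v w →
            Infected A u → Infected A w → Infected A v

Percolates : ∀ {m n} → VSet m n → Set
Percolates A = ∀ v → Infected A v

_⊂_ : ∀ {m n} → VSet m n → VSet m n → Set
B ⊂ A = (∀ v → B v ≡ true → A v ≡ true) × ∃ λ v → (A v ≡ true × B v ≡ false)

MinimalPercolating : ∀ {m n} → VSet m n → Set
MinimalPercolating A = Percolates A × (∀ B → B ⊂ A → ¬ Percolates B)

IsE : ℕ → ℕ → ℕ → Set
IsE m n e =
  (Σ (VSet m n) λ A → MinimalPercolating A × size A ≡ e)
  × (∀ (A : VSet m n) → MinimalPercolating A → size A ≤ e)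

-- By transposition it suffices to add one row. Pull a minimal percolating set A of G(m+1,n) back along
-- the map G(m+2,n) → G(m+1,n) merging rows 0 and 1. The pullback percolates, so classically it contains
-- a minimal percolating set B. The image of B under the merge percolates and lies in A, so by minimality
-- of A it is A, whence |A| ≤ |image of B| ≤ |B|. The conclusion e₁ ≤ e₂ is decidable, so this
-- classical step is harmless.
module Submission where

open import Defs
open import Data.Nat using (ℕ; zero; suc; _≤_; _<_; _+_; z≤n; s≤s; _≤′_; ≤′-refl; ≤′-step; _≤?_)
open import Data.Nat.Properties
  using (≤-refl; ≤-reflexive; ≤-trans; +-mono-≤; +-mono-<-≤; +-mono-≤-<; +-monoˡ-≤; +-assoc; suc-injective;
         ≤⇒≤′; +-0-commutativeMonoid; module ≤-Reasoning)
open import Data.Nat.Induction using (<-wellFounded)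
open import Data.Nat.ListAction as ListAction using ()
open import Algebra.Properties.CommutativeMonoid.Sum +-0-commutativeMonoid
  using (sum; ∑-distrib-+; ∑-comm; sum-replicate-zero)
open import Data.Fin using (Fin; zero; suc)
open import Data.Fin.Properties using (toℕ-injective; _≟_)
open import Data.Bool using (Bool; true; false; if_then_else_; _∨_)
open import Data.Bool.Properties using (∨-zeroʳ)
open import Data.List using (map; allFin; tabulate)
open import Data.List.Properties using (map-tabulate; map-cong)
open import Data.Product using (_×_; _,_; Σ-syntax; proj₁; swap)
open import Data.Product.Properties using (≡-dec)
open import Data.Sum using (_⊎_; inj₁; inj₂)
import Data.Sum as Sum
open import Data.Empty using (⊥; ⊥-elim)
open import Function using (_∘_; id)
open import Induction.WellFounded using (WellFounded; Acc; acc; module Subrelation)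
import Relation.Binary.Construct.On as On
open import Relation.Binary.PropositionalEquality using (_≡_; _≢_; refl; sym; trans; cong; cong₂; subst)
open import Relation.Nullary using (¬_; Dec; yes; no)
open import Relation.Nullary.Decidable using (decidable-stable; ¬¬-excluded-middle)
open import Relation.Nullary.Negation using (¬¬-Monad)
open import Effect.Monad using (RawMonad)
open import Level using (0ℓ)

open RawMonad (¬¬-Monad {0ℓ}) using (_>>=_; pure; _<$>_)

private variable
  m n s : ℕ

indicator : Bool → ℕ
indicator b = if b then 1 else 0

count : VSet m n → ℕ
count A = sum λ i → sum λ j → indicator (A (i , j))

sum-map-allFin : (f : Fin n → ℕ) → ListAction.sum (map f (allFin n)) ≡ sum f
sum-map-allFin f = trans (cong ListAction.sum (map-tabulate id f)) (sum-tabulate f)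
  where
  sum-tabulate : ∀ {n} (f : Fin n → ℕ) → ListAction.sum (tabulate f) ≡ sum f
  sum-tabulate {zero} f = refl
  sum-tabulate {suc n} f = cong (f zero +_) (sum-tabulate (f ∘ suc))

size≡count : (A : VSet m n) → size A ≡ count A
size≡count {m} A =
  trans (cong ListAction.sum (map-cong (λ i → sum-map-allFin (λ j → indicator (A (i , j)))) (allFin m)))
        (sum-map-allFin λ i → sum λ j → indicator (A (i , j)))

∑-mono-≤ : {f g : Fin n → ℕ} → (∀ i → f i ≤ g i) → sum f ≤ sum g
∑-mono-≤ {zero} f≤g = z≤n
∑-mono-≤ {suc n} f≤g = +-mono-≤ (f≤g zero) (∑-mono-≤ (f≤g ∘ suc))

∑-mono-< : {f g : Fin n → ℕ} → (∀ i → f i ≤ g i) → (k : Fin n) → f k < g k → sum f < sum g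
∑-mono-< f≤g zero fk<gk = +-mono-<-≤ fk<gk (∑-mono-≤ (f≤g ∘ suc))
∑-mono-< f≤g (suc k) fk<gk = +-mono-≤-< (f≤g zero) (∑-mono-< (f≤g ∘ suc) k fk<gk)

indicator-mono : {a b : Bool} → (a ≡ true → b ≡ true) → indicator a ≤ indicator b
indicator-mono {false} a⇒b = z≤n
indicator-mono {true} a⇒b with refl ← a⇒b refl = ≤-refl

indicator-∨ : ∀ a b → indicator (a ∨ b) ≤ indicator a + indicator b
indicator-∨ false b = ≤-refl
indicator-∨ true b = s≤s z≤n

_⊆_ : VSet m n → VSet m n → Set
B ⊆ A = ∀ v → B v ≡ true → A v ≡ true

count-mono-⊆ : {A B : VSet m n} → B ⊆ A → count B ≤ count A
count-mono-⊆ B⊆A = ∑-mono-≤ λ i → ∑-mono-≤ λ j → indicator-mono (B⊆A (i , j))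

count-mono-⊂ : {A B : VSet m n} → B ⊂ A → count B < count A
count-mono-⊂ (B⊆A , (i , j) , Av , Bv) =
  ∑-mono-< (λ i → ∑-mono-≤ λ j → indicator-mono (B⊆A (i , j))) i
    (∑-mono-< (λ j → indicator-mono (B⊆A (i , j))) j (indicator-< Bv Av))
  where
  indicator-< : ∀ {a b} → a ≡ false → b ≡ true → indicator a < indicator b
  indicator-< refl refl = s≤s z≤n

⊂-wellFounded : WellFounded (_⊂_ {m} {n})
⊂-wellFounded = Subrelation.wellFounded count-mono-⊂ (On.wellFounded count <-wellFounded)

-- Percolation is not decided here, so the search for a minimal subset runs in the double-negation monad.
minimalPercolatingSubset : (A : VSet m n) → Percolates A →
  ¬ ¬ (Σ[ B ∈ VSet m n ] MinimalPercolating B × B ⊆ A)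
minimalPercolatingSubset {m} {n} A = go A (⊂-wellFounded A)
  where
  ∃-smaller : VSet m n → Set
  ∃-smaller A = Σ[ B ∈ VSet m n ] B ⊂ A × Percolates B

  go : ∀ A → Acc _⊂_ A → Percolates A → ¬ ¬ (Σ[ B ∈ VSet m n ] MinimalPercolating B × B ⊆ A)
  go A (acc smaller) A-perc = ¬¬-excluded-middle {A = ∃-smaller A} >>= λ where
    (yes (B , B⊂A , B-perc)) → go B (smaller B⊂A) B-perc >>= λ where
      (C , C-min , C⊆B) → pure (C , C-min , λ v → proj₁ B⊂A v ∘ C⊆B v)
    (no none) → pure (A , (A-perc , λ B B⊂A B-perc → none (B , B⊂A , B-perc)) , λ _ Av → Av)

minimal-⊆ : {A B : VSet m n} → MinimalPercolating A → B ⊆ A → Percolates B → A ⊆ B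
minimal-⊆ {B = B} (_ , A-min) B⊆A B-perc v Av with B v in Bv
... | true = refl
... | false = ⊥-elim (A-min B (B⊆A , v , Av , Bv) B-perc)

_≟ᵥ_ : (u v : Vertex m n) → Dec (u ≡ v)
_≟ᵥ_ = ≡-dec _≟_ _≟_

module _ {m n m′ n′ : ℕ} (f : Vertex m n → Vertex m′ n′)
  (edge-or-collapse : ∀ {v u} → Adj v u → f u ≢ f v → Adj (f v) (f u))
  (injective-on-neighbours : ∀ {v u w} → Adj v u → Adj v w → f u ≡ f w → u ≡ w)
  where

  Infected-map : {A : VSet m n} {B : VSet m′ n′} → (∀ v → A v ≡ true → B (f v) ≡ true) →
    ∀ {v} → Infected A v → Infected B (f v)
  Infected-map A⇒B (initial Av) = initial (A⇒B _ Av)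
  Infected-map {B = B} A⇒B {v} (spread {u = u} {w = w} u≢w vu vw u-inf w-inf)
    with f u ≟ᵥ f v | f w ≟ᵥ f v
  ... | yes fu≡fv | _ = subst (Infected B) fu≡fv (Infected-map A⇒B u-inf)
  ... | no _ | yes fw≡fv = subst (Infected B) fw≡fv (Infected-map A⇒B w-inf)
  ... | no fu≢fv | no fw≢fv =
    spread (u≢w ∘ injective-on-neighbours vu vw) (edge-or-collapse vu fu≢fv) (edge-or-collapse vw fw≢fv)
      (Infected-map A⇒B u-inf) (Infected-map A⇒B w-inf)

-- Adj (i , j) (i′ , j′) unfolds to Adjℕ (toℕ i) (toℕ j) (toℕ i′) (toℕ j′).
Adjℕ : ℕ → ℕ → ℕ → ℕ → Set
Adjℕ a b a′ b′ = (a ≡ a′ × (suc b ≡ b′ ⊎ suc b′ ≡ b)) ⊎ (b ≡ b′ × (suc a ≡ a′ ⊎ suc a′ ≡ a))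

Adjℕ-suc : ∀ {a b a′ b′} → Adjℕ a b a′ b′ → Adjℕ (suc a) b (suc a′) b′
Adjℕ-suc (inj₁ (a≡a′ , b~b′)) = inj₁ (cong suc a≡a′ , b~b′)
Adjℕ-suc (inj₂ (b≡b′ , a~a′)) = inj₂ (b≡b′ , Sum.map (cong suc) (cong suc) a~a′)

Adjℕ-pred : ∀ {a b a′ b′} → Adjℕ (suc a) b (suc a′) b′ → Adjℕ a b a′ b′
Adjℕ-pred (inj₁ (a≡a′ , b~b′)) = inj₁ (suc-injective a≡a′ , b~b′)
Adjℕ-pred (inj₂ (b≡b′ , a~a′)) = inj₂ (b≡b′ , Sum.map suc-injective suc-injective a~a′)

Adjℕ-zero-suc : ∀ {b a′ b′} → Adjℕ 0 b (suc a′) b′ → a′ ≡ 0 × b ≡ b′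
Adjℕ-zero-suc (inj₂ (b≡b′ , inj₁ refl)) = refl , b≡b′

Adjℕ-sym : ∀ {a b a′ b′} → Adjℕ a b a′ b′ → Adjℕ a′ b′ a b
Adjℕ-sym (inj₁ (a≡a′ , b~b′)) = inj₁ (sym a≡a′ , Sum.swap b~b′)
Adjℕ-sym (inj₂ (b≡b′ , a~a′)) = inj₂ (sym b≡b′ , Sum.swap a~a′)

Adj-zero-suc-unique : {j c c′ : Fin n} {i i′ : Fin m} →
  Adj (zero , j) (suc i , c) → Adj (zero , j) (suc i′ , c′) → (suc i , c) ≡ (suc i′ , c′)
Adj-zero-suc-unique vu vw with Adjℕ-zero-suc vu | Adjℕ-zero-suc vw
... | i≡0 , j≡c | i′≡0 , j≡c′ =
  cong₂ _,_ (cong suc (toℕ-injective (trans i≡0 (sym i′≡0)))) (toℕ-injective (trans (sym j≡c) j≡c′))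

-- The grid has no triangles, and (0 , c), (1 , c) are adjacent.
no-common-neighbour-0-1 : ∀ {a b c} → Adjℕ a b 0 c → Adjℕ a b 1 c → ⊥
no-common-neighbour-0-1 (inj₁ (refl , inj₁ refl)) (inj₁ (() , _))
no-common-neighbour-0-1 (inj₁ (refl , inj₁ refl)) (inj₂ (() , _))
no-common-neighbour-0-1 (inj₁ (refl , inj₂ refl)) (inj₁ (() , _))
no-common-neighbour-0-1 (inj₁ (refl , inj₂ refl)) (inj₂ (() , _))
no-common-neighbour-0-1 (inj₂ (refl , inj₂ refl)) (inj₁ (_ , inj₁ ()))
no-common-neighbour-0-1 (inj₂ (refl , inj₂ refl)) (inj₁ (_ , inj₂ ()))
no-common-neighbour-0-1 (inj₂ (refl , inj₂ refl)) (inj₂ (_ , inj₁ ()))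
no-common-neighbour-0-1 (inj₂ (refl , inj₂ refl)) (inj₂ (_ , inj₂ ()))

merge : Vertex (suc (suc m)) n → Vertex (suc m) n
merge (zero , j) = (zero , j)
merge (suc i , j) = (i , j)

upper lower : Vertex (suc m) n → Vertex (suc (suc m)) n
upper (i , j) = (suc i , j)
lower (zero , j) = (zero , j)
lower (suc i , j) = (suc (suc i) , j)

pullback : VSet (suc m) n → VSet (suc (suc m)) n
pullback A = A ∘ merge

pushforward : VSet (suc (suc m)) n → VSet (suc m) n
pushforward B (zero , j) = B (zero , j) ∨ B (suc zero , j)
pushforward B (suc i , j) = B (suc (suc i) , j)

merge-collapses-0-1 : {j c : Fin n} {i : Fin (suc m)} →
  Adj (zero , j) (suc i , c) → merge (suc i , c) ≡ merge (zero , j)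
merge-collapses-0-1 vu with Adjℕ-zero-suc vu
... | i≡0 , j≡c = cong₂ _,_ (toℕ-injective i≡0) (sym (toℕ-injective j≡c))

merge-Adj : {v u : Vertex (suc (suc m)) n} → Adj v u → merge u ≢ merge v → Adj (merge v) (merge u)
merge-Adj {v = zero , _} {zero , _} vu _ = vu
merge-Adj {v = zero , _} {suc _ , _} vu not-collapsed = ⊥-elim (not-collapsed (merge-collapses-0-1 vu))
merge-Adj {v = suc _ , _} {zero , _} vu not-collapsed =
  ⊥-elim (not-collapsed (sym (merge-collapses-0-1 (Adjℕ-sym vu))))
merge-Adj {v = suc _ , _} {suc _ , _} vu _ = Adjℕ-pred vu

merge-injective-on-neighbours : {v u w : Vertex (suc (suc m)) n} →
  Adj v u → Adj v w → merge u ≡ merge w → u ≡ w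
merge-injective-on-neighbours {u = zero , _} {zero , _} _ _ refl = refl
merge-injective-on-neighbours {u = suc _ , _} {suc _ , _} _ _ refl = refl
merge-injective-on-neighbours {u = zero , _} {suc _ , _} vu vw refl = ⊥-elim (no-common-neighbour-0-1 vu vw)
merge-injective-on-neighbours {u = suc _ , _} {zero , _} vu vw refl = ⊥-elim (no-common-neighbour-0-1 vw vu)

pushforward-image : {B : VSet (suc (suc m)) n} → ∀ v → B v ≡ true → pushforward B (merge v) ≡ true
pushforward-image {B = B} (zero , j) Bv = cong (_∨ B (suc zero , j)) Bv
pushforward-image {B = B} (suc zero , j) Bv = trans (cong (B (zero , j) ∨_) Bv) (∨-zeroʳ _)
pushforward-image (suc (suc _) , _) Bv = Bv

Infected-pushforward : {B : VSet (suc (suc m)) n} → ∀ {v} → Infected B v → Infected (pushforward B) (merge v)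
Infected-pushforward = Infected-map merge merge-Adj merge-injective-on-neighbours pushforward-image

Infected-upper : {A : VSet (suc m) n} → ∀ {v} → Infected A v → Infected (pullback A) (upper v)
Infected-upper = Infected-map upper (λ vu _ → Adjℕ-suc vu) (λ _ _ → upper-injective) (λ _ Av → Av)
  where
  upper-injective : ∀ {u w} → upper {m} {n} u ≡ upper w → u ≡ w
  upper-injective refl = refl

-- Row 0 of the small grid is infected along row 0 of the large one, helped by row 1 of the large grid,
-- which is infected as a copy of the whole small grid.
Infected-lower : {A : VSet (suc m) n} → ∀ {v} → Infected A v → Infected (pullback A) (lower v)
Infected-lower {v = suc _ , _} v-inf = Infected-upper v-inf
Infected-lower {v = zero , _} (initial Av) = initial Av
Infected-lower {v = zero , _} v-inf@(spread {u = zero , _} _ vu _ u-inf _) =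
  spread (λ ()) vu (inj₂ (refl , inj₁ refl)) (Infected-lower u-inf) (Infected-upper v-inf)
Infected-lower {v = zero , _} v-inf@(spread {u = suc _ , _} {w = zero , _} _ _ vw _ w-inf) =
  spread (λ ()) vw (inj₂ (refl , inj₁ refl)) (Infected-lower w-inf) (Infected-upper v-inf)
Infected-lower {v = zero , _} (spread {u = suc _ , _} {w = suc _ , _} u≢w vu vw _ _) =
  ⊥-elim (u≢w (Adj-zero-suc-unique vu vw))

pullback-percolates : {A : VSet (suc m) n} → Percolates A → Percolates (pullback A)
pullback-percolates A-perc (zero , j) = Infected-lower (A-perc (zero , j))
pullback-percolates A-perc (suc i , j) = Infected-upper (A-perc (i , j))

pushforward-percolates : {B : VSet (suc (suc m)) n} → Percolates B → Percolates (pushforward B)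
pushforward-percolates B-perc (i , j) = Infected-pushforward (B-perc (suc i , j))

pushforward-⊆ : {A : VSet (suc m) n} {B : VSet (suc (suc m)) n} → B ⊆ pullback A → pushforward B ⊆ A
pushforward-⊆ {B = B} B⊆A (zero , j) B′v with B (zero , j) in B0j
... | true = B⊆A (zero , j) B0j
... | false = B⊆A (suc zero , j) B′v
pushforward-⊆ B⊆A (suc i , j) B′v = B⊆A (suc (suc i) , j) B′v

count-pushforward : (B : VSet (suc (suc m)) n) → count (pushforward B) ≤ count B
count-pushforward B = begin
  sum (λ j → indicator (B (zero , j) ∨ B (suc zero , j))) + rest
    ≤⟨ +-monoˡ-≤ rest (∑-mono-≤ λ j → indicator-∨ (B (zero , j)) (B (suc zero , j))) ⟩
  sum (λ j → row zero j + row (suc zero) j) + rest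
    ≡⟨ cong (_+ rest) (∑-distrib-+ (row zero) (row (suc zero))) ⟩
  sum (row zero) + sum (row (suc zero)) + rest
    ≡⟨ +-assoc (sum (row zero)) _ rest ⟩
  count B ∎
  where
  open ≤-Reasoning
  row : Fin (suc (suc _)) → Fin _ → ℕ
  row i j = indicator (B (i , j))
  rest : ℕ
  rest = sum λ i → sum (row (suc (suc i)))

MinimalAtLeast : ℕ → ℕ → ℕ → Set
MinimalAtLeast m n s = Σ[ A ∈ VSet m n ] MinimalPercolating A × s ≤ count A

extendRow : MinimalAtLeast (suc m) n s → ¬ ¬ MinimalAtLeast (suc (suc m)) n s
extendRow (A , A-min@(A-perc , _) , s≤A) =
  (λ (B , B-min , B⊆A) → B , B-min , ≤-trans s≤A (A≤B B-min B⊆A))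
    <$> minimalPercolatingSubset (pullback A) (pullback-percolates A-perc)
  where
  open ≤-Reasoning
  A≤B : ∀ {B} → MinimalPercolating B → B ⊆ pullback A → count A ≤ count B
  A≤B {B} (B-perc , _) B⊆A = begin
    count A               ≤⟨ count-mono-⊆ A⊆B′ ⟩
    count (pushforward B) ≤⟨ count-pushforward B ⟩
    count B               ∎
    where
    A⊆B′ : A ⊆ pushforward B
    A⊆B′ = minimal-⊆ A-min (pushforward-⊆ B⊆A) (pushforward-percolates B-perc)

extendRows : ∀ {k} → k ≤′ m → MinimalAtLeast (suc k) n s → ¬ ¬ MinimalAtLeast (suc m) n s
extendRows ≤′-refl A = pure A
extendRows (≤′-step k≤m) A = extendRows k≤m A >>= extendRow

transpose : VSet m n → VSet n m
transpose A = A ∘ swap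

Infected-transpose : {A : VSet m n} → ∀ {v} → Infected A v → Infected (transpose A) (swap v)
Infected-transpose = Infected-map swap (λ vu _ → Sum.swap vu) (λ _ _ → swap-injective) (λ _ Av → Av)
  where
  swap-injective : ∀ {u w : Vertex m n} → swap u ≡ swap w → u ≡ w
  swap-injective refl = refl

Percolates-transpose : {A : VSet m n} → Percolates A → Percolates (transpose A)
Percolates-transpose A-perc v = Infected-transpose (A-perc (swap v))

MinimalPercolating-transpose : {A : VSet m n} → MinimalPercolating A → MinimalPercolating (transpose A)
MinimalPercolating-transpose {A = A} (A-perc , A-min) = Percolates-transpose A-perc , minimal
  where
  minimal : ∀ B → B ⊂ transpose A → ¬ Percolates B
  minimal B (B⊆A , v , Av , Bv) B-perc =
    A-min (transpose B) ((λ u → B⊆A (swap u)) , swap v , Av , Bv) (Percolates-transpose B-perc)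

count-transpose : (A : VSet m n) → count (transpose A) ≡ count A
count-transpose A = ∑-comm λ j i → indicator (A (i , j))

MinimalAtLeast-transpose : MinimalAtLeast m n s → MinimalAtLeast n m s
MinimalAtLeast-transpose (A , A-min , s≤A) =
  transpose A , MinimalPercolating-transpose A-min , ≤-trans s≤A (≤-reflexive (sym (count-transpose A)))

extendColumns : ∀ {k} → k ≤′ n → MinimalAtLeast m (suc k) s → ¬ ¬ MinimalAtLeast m (suc n) s
extendColumns k≤n A = MinimalAtLeast-transpose <$> extendRows k≤n (MinimalAtLeast-transpose A)

size-no-columns : (A : VSet m 0) → size A ≡ 0
size-no-columns {m} A = trans (size≡count A) (sum-replicate-zero m)

lemma3p1 : ∀ (k ℓ m n : ℕ) → k ≤ m → ℓ ≤ n →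
    ∀ (e₁ e₂ : ℕ) → IsE k ℓ e₁ → IsE m n e₂ → e₁ ≤ e₂
lemma3p1 zero ℓ m n _ _ e₁ e₂ ((A , _ , refl) , _) _ = z≤n
lemma3p1 (suc k) zero m n _ _ e₁ e₂ ((A , _ , refl) , _) _ rewrite size-no-columns A = z≤n
lemma3p1 (suc k) (suc ℓ) (suc m) (suc n) (s≤s k≤m) (s≤s ℓ≤n) e₁ e₂ ((A , A-min , refl) , _) (_ , maximum) =
  decidable-stable (size A ≤? e₂) do
    B ← extendRows (≤⇒≤′ k≤m) (A , A-min , ≤-reflexive (size≡count A))
    (C , C-min , A≤C) ← extendColumns (≤⇒≤′ ℓ≤n) B
    pure (≤-trans A≤C (≤-trans (≤-reflexive (sym (size≡count C))) (maximum C C-min)))
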